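{- Let $G$ be a graph and $q\ge 1$ an integer. Let $U\coloneqq\{u\in V(G)\mid |N_{G^2}[u]|>q\}$ and $W\coloneqq U\cup N_G(U)$. Then $G$ has a square $q$-coloring if and only if the induced subgraph $G[W]$ has a square $q$-coloring.
   Context: $G^2$ is the square of $G$ (same vertices, distinct vertices adjacent iff at distance at most $2$ in $G$); $N_{G^2}[u]$ is the closed neighborhood of $u$ in $G^2$, i.e., the set of vertices at distance at most $2$ from $u$ in $G$. For $X\subseteq V(G)$, $N_G(X)=(\bigcup_{v\in X}N_G(v))\setminus X$. A square $q$-coloring of $G$ is a map $V(G)\to\{1,\dots,q\}$ giving distinct colors to distinct vertices at distance at most $2$ in $G$. -}

module Defs where

open import Data.Nat using (ℕ; _<_)
open import Data.Bool using (Bool; true; false; T; _∨_; _∧_)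
open import Data.Fin using (Fin; _≟_)
open import Data.List using (List; length; filter)
open import Data.Bool.ListAction using (any)
open import Data.List.Base using (allFin)
open import Data.Product using (Σ; _×_; _,_; proj₁)
open import Data.Sum using (_⊎_)
open import Relation.Binary.PropositionalEquality using (_≡_; _≢_)
open import Relation.Nullary.Decidable using (⌊_⌋)
open import Function.Base using (_∘_)

record Graph (n : ℕ) : Set where
  field
    adj     : Fin n → Fin n → Bool
    adj-sym : ∀ u v → adj u v ≡ adj v u
    irrefl  : ∀ u → adj u u ≡ false
open Graph public

AtDist≤2 : {V : Set} → (V → V → Bool) → V → V → Set
AtDist≤2 {V} E u v = T (E u v) ⊎ Σ V (λ w → T (E u w) × T (E w v))

SquareColoring : (V : Set) → (V → V → Bool) → ℕ → Set
SquareColoring V E q =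
  Σ (V → Fin q) λ c → ∀ u v → u ≢ v → AtDist≤2 E u v → c u ≢ c v

HasSquareColoring : ∀ {n} → Graph n → ℕ → Set
HasSquareColoring {n} G q = SquareColoring (Fin n) (adj G) q

inSqNbr : ∀ {n} → Graph n → Fin n → Fin n → Bool
inSqNbr {n} G u v =
  ⌊ u ≟ v ⌋ ∨ adj G u v ∨ any (λ w → adj G u w ∧ adj G w v) (allFin n)

sqNbrSize : ∀ {n} → Graph n → Fin n → ℕ
sqNbrSize {n} G u = length (filter (λ v → T? (inSqNbr G u v)) (allFin n))
  where
  open import Data.Bool.Properties using (T?)

InU : ∀ {n} → Graph n → ℕ → Fin n → Bool
InU G q u = ⌊ q Data.Nat.<? sqNbrSize G u ⌋
  where import Data.Nat

InW : ∀ {n} → Graph n → ℕ → Fin n → Bool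
InW {n} G q v = InU G q v ∨ any (λ u → InU G q u ∧ adj G u v) (allFin n)

WVert : ∀ {n} → Graph n → ℕ → Set
WVert {n} G q = Σ (Fin n) (λ v → T (InW G q v))

WAdj : ∀ {n} (G : Graph n) (q : ℕ) → WVert G q → WVert G q → Bool
WAdj G q x y = adj G (proj₁ x) (proj₁ y)

InducedWHasSquareColoring : ∀ {n} → Graph n → ℕ → Set
InducedWHasSquareColoring G q = SquareColoring (WVert G q) (WAdj G q) q

{-# OPTIONS --safe #-}
-- Restricting a square colouring of G to W gives one direction.  Conversely, two
-- vertices of U at distance ≤ 2 in G are still at distance ≤ 2 in G[W], because a
-- common neighbour of a vertex of U lies in W; so a square colouring of G[W] is
-- proper on U.  Every vertex v outside U has |N_{G²}[v]| ≤ q, hence fewer than q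
-- other vertices within distance 2, so the vertices outside U can be recoloured
-- greedily, one at a time, each with a colour missing from its square neighbourhood.
module Submission where

open import Defs
open import Data.Nat using (ℕ; _≥_; _≤_; _<_)
import Data.Nat as ℕ
open import Data.Nat.Properties using (<-≤-trans; ≮⇒≥)
open import Data.Bool using (Bool; T; _∧_)
open import Data.Bool.ListAction using (any)
open import Data.Bool.Properties using (T-∨; T-∧; T-irrelevant; T?)
open import Data.Empty using (⊥-elim)
open import Data.Fin using (Fin; _≟_; fromℕ<)
open import Data.Fin.Properties using (pigeonhole; ¬∀⟶∃¬; <⇒≢)
open import Data.List using (List; []; _∷_; length; filter; map; allFin; lookup)
open import Data.List.Properties using (length-map; filter-notAll)
open import Data.List.Membership.Propositional using (_∈_; _∉_; lose)
open import Data.List.Membership.Propositional.Properties using (∈-allFin; ∈-filter⁺; ∈-map⁺)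
import Data.List.Membership.DecPropositional as DecMembership
open import Data.List.Relation.Unary.Any using (here; there; index)
open import Data.List.Relation.Unary.Any.Properties using (lookup-index; any⁺)
open import Data.Product using (Σ; ∃; _×_; _,_; proj₁; proj₂)
import Data.Product as Product
open import Data.Sum using (_⊎_; inj₁; inj₂; map₂)
open import Data.Vec.Functional using (updateAt)
open import Data.Vec.Functional.Properties using (updateAt-updates; updateAt-minimal)
open import Function.Base using (_∘_; const)
open import Function.Bundles using (Equivalence)
open import Relation.Nullary using (¬_; yes; no)
open import Relation.Nullary.Decidable using (⌊_⌋; ¬?; fromWitness)
open import Relation.Unary using (_⊆_)
open import Relation.Binary.PropositionalEquality
  using (_≡_; _≢_; refl; sym; trans; cong; subst; module ≡-Reasoning)

open Equivalence using (from)
open ≡-Reasoning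

fresh-colour : ∀ {q} (L : List (Fin q)) → length L < q → ∃ λ x → x ∉ L
fresh-colour {q} L |L|<q = ¬∀⟶∃¬ q (_∈ L) (_∈? L) not-all
  where
  open DecMembership (_≟_ {q}) using (_∈?_)

  not-all : ¬ (∀ x → x ∈ L)
  not-all x∈L with i , j , i<j , same-index ← pigeonhole |L|<q (index ∘ x∈L) =
    <⇒≢ i<j (begin
      i                        ≡⟨ lookup-index (x∈L i) ⟩
      lookup L (index (x∈L i)) ≡⟨ cong (lookup L) same-index ⟩
      lookup L (index (x∈L j)) ≡⟨ lookup-index (x∈L j) ⟨
      j                        ∎)

restrict-SquareColoring : ∀ {n} (G : Graph n) {q} (keep : Fin n → Bool) →
  HasSquareColoring G q →
  SquareColoring (Σ (Fin n) (T ∘ keep)) (λ x y → adj G (proj₁ x) (proj₁ y)) q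
restrict-SquareColoring {n} G keep (c , proper) = c ∘ proj₁ , proper′
  where
  Vertex : Set
  Vertex = Σ (Fin n) (T ∘ keep)
  E : Vertex → Vertex → Bool
  E x y = adj G (proj₁ x) (proj₁ y)

  proj₁-AtDist≤2 : ∀ {x y} → AtDist≤2 E x y → AtDist≤2 (adj G) (proj₁ x) (proj₁ y)
  proj₁-AtDist≤2 = map₂ λ ((w , _) , uw , wv) → w , uw , wv

  proj₁-injective : {x y : Vertex} → x ≢ y → proj₁ x ≢ proj₁ y
  proj₁-injective {u , pu} {_ , pv} x≢y refl = x≢y (cong (u ,_) (T-irrelevant pu pv))

  proper′ : ∀ x y → x ≢ y → AtDist≤2 E x y → c (proj₁ x) ≢ c (proj₁ y)
  proper′ x y x≢y d =
    proper (proj₁ x) (proj₁ y) (proj₁-injective {x} {y} x≢y) (proj₁-AtDist≤2 {x} {y} d)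

module _ {n : ℕ} (G : Graph n) where

  AtDist≤2-sym : ∀ {u v} → AtDist≤2 (adj G) u v → AtDist≤2 (adj G) v u
  AtDist≤2-sym {u} {v} (inj₁ uv) = inj₁ (subst T (adj-sym G u v) uv)
  AtDist≤2-sym {u} {v} (inj₂ (w , uw , wv)) =
    inj₂ (w , subst T (adj-sym G w v) wv , subst T (adj-sym G u w) uw)

  inSqNbr-refl : ∀ u → T (inSqNbr G u u)
  inSqNbr-refl u = from T-∨ (inj₁ (fromWitness {a? = u ≟ u} refl))

  AtDist≤2⇒inSqNbr : ∀ {u v} → AtDist≤2 (adj G) u v → T (inSqNbr G u v)
  AtDist≤2⇒inSqNbr {u} {v} d = from (T-∨ {⌊ u ≟ v ⌋}) (inj₂ (from T-∨ (map₂ through d)))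
    where
    through : Σ (Fin n) (λ w → T (adj G u w) × T (adj G w v)) →
              T (any (λ w → adj G u w ∧ adj G w v) (allFin n))
    through (w , uw , wv) = any⁺ _ (lose (∈-allFin w) (from T-∧ (uw , wv)))

  otherSqNbrs : Fin n → List (Fin n)
  otherSqNbrs v =
    filter (λ w → ¬? (w ≟ v)) (filter (λ w → T? (inSqNbr G v w)) (allFin n))

  length-otherSqNbrs : ∀ v → length (otherSqNbrs v) < sqNbrSize G v
  length-otherSqNbrs v = filter-notAll (λ w → ¬? (w ≟ v)) _
    (lose (∈-filter⁺ (λ w → T? (inSqNbr G v w)) (∈-allFin v) (inSqNbr-refl v))
          (λ v≢v → v≢v refl))

  ∈-otherSqNbrs : ∀ {v w} → w ≢ v → AtDist≤2 (adj G) v w → w ∈ otherSqNbrs v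
  ∈-otherSqNbrs {v} {w} w≢v d =
    ∈-filter⁺ _ (∈-filter⁺ (λ w → T? (inSqNbr G v w)) (∈-allFin w) (AtDist≤2⇒inSqNbr d)) w≢v

  SquareColoringOn : ∀ {q} → (Fin n → Set) → (Fin n → Fin q) → Set
  SquareColoringOn D c =
    ∀ u v → D u → D v → u ≢ v → AtDist≤2 (adj G) u v → c u ≢ c v

  SquareColoringOn-anti : ∀ {q} {D D′ : Fin n → Set} {c : Fin n → Fin q} →
    D′ ⊆ D → SquareColoringOn D c → SquareColoringOn D′ c
  SquareColoringOn-anti D′⊆D proper u v D′u D′v = proper u v (D′⊆D D′u) (D′⊆D D′v)

  SquareColoringOn-extend : ∀ {q} {D : Fin n → Set} {c : Fin n → Fin q} →
    SquareColoringOn D c → ∀ v → sqNbrSize G v ≤ q →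
    ∃ λ c′ → SquareColoringOn (λ u → D u ⊎ u ≡ v) c′
  SquareColoringOn-extend {q} {D} {c} proper v small = c′ , proper′
    where
    L : List (Fin q)
    L = map c (otherSqNbrs v)

    |L|<q : length L < q
    |L|<q = subst (_< q) (sym (length-map c (otherSqNbrs v)))
                  (<-≤-trans (length-otherSqNbrs v) small)

    x : Fin q
    x = proj₁ (fresh-colour L |L|<q)

    c′ : Fin n → Fin q
    c′ = updateAt c v (const x)

    unchanged : ∀ {u} → u ≢ v → c′ u ≡ c u
    unchanged {u} u≢v = updateAt-minimal u v c u≢v

    distinct-at-v : ∀ w → w ≢ v → AtDist≤2 (adj G) v w → c′ v ≢ c′ w
    distinct-at-v w w≢v d c′v≡c′w = proj₂ (fresh-colour L |L|<q)
      (subst (_∈ L) c-w≡x (∈-map⁺ c (∈-otherSqNbrs w≢v d)))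
      where
      c-w≡x : c w ≡ x
      c-w≡x = begin
        c w  ≡⟨ unchanged w≢v ⟨
        c′ w ≡⟨ c′v≡c′w ⟨
        c′ v ≡⟨ updateAt-updates v c ⟩
        x    ∎

    old : ∀ {u} → D u ⊎ u ≡ v → u ≢ v → D u
    old (inj₁ Du) _ = Du
    old (inj₂ u≡v) u≢v = ⊥-elim (u≢v u≡v)

    proper′ : SquareColoringOn (λ u → D u ⊎ u ≡ v) c′
    proper′ u w Du Dw u≢w d with u ≟ v | w ≟ v
    ... | yes refl | yes refl = ⊥-elim (u≢w refl)
    ... | yes refl | no w≢v = distinct-at-v w w≢v d
    ... | no u≢v | yes refl = distinct-at-v u u≢v (AtDist≤2-sym d) ∘ sym
    ... | no u≢v | no w≢v = λ c′u≡c′w → proper u w (old Du u≢v) (old Dw w≢v) u≢w d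
      (trans (sym (unchanged u≢v)) (trans c′u≡c′w (unchanged w≢v)))

module _ {n : ℕ} (G : Graph n) (q : ℕ) where

  InU⇒InW : ∀ {u} → T (InU G q u) → T (InW G q u)
  InU⇒InW u∈U = from T-∨ (inj₁ u∈U)

  adj-InU⇒InW : ∀ {u w} → T (InU G q u) → T (adj G u w) → T (InW G q w)
  adj-InU⇒InW {u} {w} u∈U uw =
    from (T-∨ {InU G q w}) (inj₂ (any⁺ _ (lose (∈-allFin u) (from T-∧ (u∈U , uw)))))

  ¬InU⇒sqNbrSize≤ : ∀ {u} → ¬ T (InU G q u) → sqNbrSize G u ≤ q
  ¬InU⇒sqNbrSize≤ {u} u∉U =
    ≮⇒≥ (u∉U ∘ fromWitness {a? = q ℕ.<? sqNbrSize G u})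

  AtDist≤2-inW : ∀ {u v} (u∈U : T (InU G q u)) (v∈U : T (InU G q v)) →
    AtDist≤2 (adj G) u v → AtDist≤2 (WAdj G q) (u , InU⇒InW u∈U) (v , InU⇒InW v∈U)
  AtDist≤2-inW u∈U _ = map₂ λ (w , uw , wv) → (w , adj-InU⇒InW u∈U uw) , uw , wv

  module _ (colouringW : InducedWHasSquareColoring G q) (default : Fin q) where

    cW : WVert G q → Fin q
    cW = proj₁ colouringW

    -- The colour off W is arbitrary: every vertex outside U is recoloured later.
    extendW : Fin n → Fin q
    extendW u with T? (InW G q u)
    ... | yes u∈W = cW (u , u∈W)
    ... | no _    = default

    extendW-inW : ∀ {u} (u∈W : T (InW G q u)) → extendW u ≡ cW (u , u∈W)
    extendW-inW {u} u∈W with T? (InW G q u)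
    ... | yes u∈W′ = cong (λ p → cW (u , p)) (T-irrelevant u∈W′ u∈W)
    ... | no u∉W   = ⊥-elim (u∉W u∈W)

    extendW-onU : SquareColoringOn G (T ∘ InU G q) extendW
    extendW-onU u v u∈U v∈U u≢v d eq =
      proj₂ colouringW (u , InU⇒InW u∈U) (v , InU⇒InW v∈U)
        (u≢v ∘ cong proj₁) (AtDist≤2-inW u∈U v∈U d)
        (trans (sym (extendW-inW _)) (trans eq (extendW-inW _)))

    colouring-U∪ : ∀ xs → ∃ λ c → SquareColoringOn G (λ u → T (InU G q u) ⊎ u ∈ xs) c
    colouring-U∪ [] = extendW , SquareColoringOn-anti G (λ { (inj₁ u∈U) → u∈U }) extendW-onU
    colouring-U∪ (x ∷ xs) with colouring-U∪ xs | T? (InU G q x)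
    ... | c , proper | yes x∈U = c , SquareColoringOn-anti G absorb proper
      where
      absorb : ∀ {u} → T (InU G q u) ⊎ u ∈ x ∷ xs → T (InU G q u) ⊎ u ∈ xs
      absorb (inj₁ u∈U)          = inj₁ u∈U
      absorb (inj₂ (here refl))  = inj₁ x∈U
      absorb (inj₂ (there u∈xs)) = inj₂ u∈xs
    ... | c , proper | no x∉U =
      Product.map₂ (SquareColoringOn-anti G split)
        (SquareColoringOn-extend G proper x (¬InU⇒sqNbrSize≤ {x} x∉U))
      where
      split : ∀ {u} → T (InU G q u) ⊎ u ∈ x ∷ xs → (T (InU G q u) ⊎ u ∈ xs) ⊎ u ≡ x
      split (inj₁ u∈U)          = inj₁ (inj₁ u∈U)
      split (inj₂ (here u≡x))   = inj₂ u≡x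
      split (inj₂ (there u∈xs)) = inj₁ (inj₂ u∈xs)

    squareColoring-fromW : HasSquareColoring G q
    squareColoring-fromW with c , proper ← colouring-U∪ (allFin n) =
      c , λ u v → proper u v (inj₂ (∈-allFin u)) (inj₂ (∈-allFin v))

lemma5p6 : ∀ {n} (G : Graph n) (q : ℕ) → q ≥ 1 →
    (HasSquareColoring G q → InducedWHasSquareColoring G q) ×
    (InducedWHasSquareColoring G q → HasSquareColoring G q)
lemma5p6 G q q≥1 =
  restrict-SquareColoring G (InW G q) ,
  λ colouringW → squareColoring-fromW G q colouringW (fromℕ< q≥1)
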